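{- Let $A$ and $B$ be automata. (1) If $(b,n)$ is a normed backward simulation from $A$ to $B$, then $b$ is a branching backward simulation from $A$ to $B$. (2) Let $b$ be a branching backward simulation from $A$ to $B$. For $s\in\mathit{start}(A)$ and $u\in\mathit{states}(B)$ let $n(s,u)=0$ if $u\notin b[s]$, and otherwise let $n(s,u)$ be the length of the shortest execution of $B$ that ends in $u$ and corresponds via $b$ to the one-state execution $s$ of $A$; for a step $t\xrightarrow{a}s$ of $A$ let $n(t\xrightarrow{a}s,u)=0$ if $u\notin b[s]$, and otherwise the length of the shortest execution fragment of $B$ that ends in $u$ and corresponds via $b$ to the execution fragment $t\,a\,s$. (If $s$ is both a start state and the target of a step these are separate arguments of $n$.) Then $(b,n)$ is a normed backward simulation from $A$ to $B$.
   Context: An automaton $A$ consists of a set $\mathit{states}(A)$, a nonempty set $\mathit{start}(A)\subseteq\mathit{states}(A)$, a set $\mathit{acts}(A)$ of actions containing a distinguished internal action $\tau$, and $\mathit{steps}(A)\subseteq \mathit{states}(A)\times\mathit{acts}(A)\times\mathit{states}(A)$; write $s\xrightarrow{a}_A t$. An execution fragment is a finite or infinite alternating sequence $s_0a_1s_1\cdots$ starting with a state (ending with a state if finite) with $s_{i-1}\xrightarrow{a_i}_A s_i$; an execution starts in a start state; length = number of steps. Write $b[s]=\{u\mid(s,u)\in b\}$. Correspondence: for $R\subseteq\mathit{states}(A)\times\mathit{states}(B)$ and execution fragments $\alpha=s_0a_1s_1\cdots$ of $A$, $\alpha'=u_0b_1u_1\cdots$ of $B$ with state index sets $\mathrm{Ind}(\alpha),\mathrm{Ind}(\alpha')$,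 they correspond via $R$ if there is $I\subseteq\mathrm{Ind}(\alpha)\times\mathrm{Ind}(\alpha')$ with: (1) $(i,j)\in I\Rightarrow(s_i,u_j)\in R$; (2) $(i,j),(i',j')\in I$, $i<i'\Rightarrow j\le j'$; (3) $I$ and $I^{ -1}$ total; (4) $(i,j),(i+1,j+1)\in I\Rightarrow a_{i+1}=b_{j+1}$; $(i,j),(i+1,j)\in I\Rightarrow a_{i+1}=\tau$; $(i,j),(i,j+1)\in I\Rightarrow b_{j+1}=\tau$. A normed backward simulation from $A$ to $B$ is a pair $(b,n)$ with $b\subseteq\mathit{states}(A)\times\mathit{states}(B)$ total and $n:(\mathit{steps}(A)\cup\mathit{start}(A))\times\mathit{states}(B)\to S$ for a well-founded ordered set $(S,<)$, such that (1) if $s\in\mathit{start}(A)$ and $u\in b[s]$ then (a) $u\in\mathit{start}(B)$, or (b) $\exists v\in b[s]: v\xrightarrow{\tau}_B u$ and $n(s,v)<n(s,u)$; (2) if $t\xrightarrow{a}_A s$ and $u\in b[s]$ then (a) $u\in b[t]$ and $a=\tau$, or (b) $\exists v\in b[t]: v\xrightarrow{a}_B u$, or (c) $\exists v\in b[s]: v\xrightarrow{\tau}_B u$ and $n(t\xrightarrow{a}s,v)<n(t\xrightarrow{a}s,u)$. A branching backward simulation from $A$ to $B$ is a total relation $b\subseteq\mathit{states}(A)\times\mathit{states}(B)$ such that (1) if $s\in\mathit{start}(A)$ and $u\in b[s]$ then $B$ has an execution ending in $u$ that corresponds via $b$ to the one-state execution $s$; (2) if $t\xrightarrow{a}_A s$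 and $u\in b[s]$ then $B$ has an execution fragment ending in $u$ that corresponds via $b$ to $t\,a\,s$. -}

module Defs where

open import Data.Nat using (ℕ; zero; suc; _≤_)
open import Data.Fin using (Fin; zero; suc; inject₁; fromℕ; _<_)
open import Data.Product using (Σ; ∃; _×_; _,_)
open import Data.Sum using (_⊎_)
open import Relation.Nullary using (¬_)
open import Relation.Binary.PropositionalEquality using (_≡_)

record Automaton (Act : Set) (τ : Act) : Set₁ where
  field
    State    : Set
    start    : State → Set
    start-ne : ∃ λ s → start s
    acts     : Act → Set
    τ∈acts   : acts τ
    step     : State → Act → State → Set
    step-act : ∀ {s a t} → step s a t → acts a
open Automaton public

record Seq (St Act : Set) : Set where
  constructor mkSeq
  field
    len : ℕ
    st  : Fin (suc len) → St
    ac  : Fin len → Act             -- ac i = a_{i+1}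
open Seq public

first : ∀ {St Act} → Seq St Act → St
first σ = st σ zero

last : ∀ {St Act} → Seq St Act → St
last σ = st σ (fromℕ (len σ))

IsFragment : ∀ {Act τ} (A : Automaton Act τ) → Seq (State A) Act → Set
IsFragment A σ = ∀ (i : Fin (len σ)) → step A (st σ (inject₁ i)) (ac σ i) (st σ (suc i))

IsExecution : ∀ {Act τ} (A : Automaton Act τ) → Seq (State A) Act → Set
IsExecution A σ = IsFragment A σ × start A (first σ)

oneState : ∀ {St Act} → St → Seq St Act
oneState s = mkSeq 0 (λ _ → s) (λ ())

stepSeq : ∀ {St Act} → St → Act → St → Seq St Act
stepSeq t a s = mkSeq 1 (λ { zero → t ; (suc zero) → s }) (λ { zero → a })

record CorrespondsVia {SA SB Act : Set} (τ : Act) (R : SA → SB → Set)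
         (α : Seq SA Act) (α' : Seq SB Act) : Set₁ where
  field
    I      : Fin (suc (len α)) → Fin (suc (len α')) → Set
    c1     : ∀ {i j} → I i j → R (st α i) (st α' j)
    c2     : ∀ {i j i' j'} → I i j → I i' j' → i < i' → Data.Fin._≤_ j j'
    totI   : ∀ i → ∃ λ j → I i j
    totI⁻¹ : ∀ j → ∃ λ i → I i j
    c4a    : ∀ (i : Fin (len α)) (j : Fin (len α')) →
             I (inject₁ i) (inject₁ j) → I (suc i) (suc j) → ac α i ≡ ac α' j
    c4b    : ∀ (i : Fin (len α)) (j : Fin (suc (len α'))) →
             I (inject₁ i) j → I (suc i) j → ac α i ≡ τ
    c4c    : ∀ (i : Fin (suc (len α))) (j : Fin (len α')) →
             I i (inject₁ j) → I i (suc j) → ac α' j ≡ τ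

Total : {X Y : Set} → (X → Y → Set) → Set
Total {X} R = ∀ (x : X) → ∃ λ y → R x y

-- The norm n on (steps(A) ∪ start(A)) × states(B)
-- is given by two functions: nStart on start states, nStep on (triples of) steps;
-- their values outside start(A) / steps(A) are irrelevant.
record NormedBackSim {Act : Set} {τ : Act} (A B : Automaton Act τ)
         (b : State A → State B → Set)
         {S : Set} (_<ₛ_ : S → S → Set)
         (nStart : State A → State B → S)
         (nStep  : State A → Act → State A → State B → S) : Set where
  field
    total : Total b
    cond1 : ∀ {s u} → start A s → b s u →
            start B u ⊎ (∃ λ v → b s v × step B v τ u × nStart s v <ₛ nStart s u)
    cond2 : ∀ {t a s u} → step A t a s → b s u →
            (b t u × a ≡ τ)
            ⊎ (∃ λ v → b t v × step B v a u)
            ⊎ (∃ λ v → b s v × step B v τ u × nStep t a s v <ₛ nStep t a s u)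

record BranchingBackSim {Act : Set} {τ : Act} (A B : Automaton Act τ)
         (b : State A → State B → Set) : Set₁ where
  field
    total : Total b
    cond1 : ∀ {s u} → start A s → b s u →
            ∃ λ (σ : Seq (State B) Act) →
              IsExecution B σ × last σ ≡ u × CorrespondsVia τ b (oneState s) σ
    cond2 : ∀ {t a s u} → step A t a s → b s u →
            ∃ λ (σ : Seq (State B) Act) →
              IsFragment B σ × last σ ≡ u × CorrespondsVia τ b (stepSeq t a s) σ

IsLeast : (ℕ → Set₁) → ℕ → Set₁
IsLeast P m = P m × (∀ k → P k → m ≤ k)

record CanonicalNorm {Act : Set} {τ : Act} (A B : Automaton Act τ)
         (b : State A → State B → Set)
         (nStart : State A → State B → ℕ)
         (nStep  : State A → Act → State A → State B → ℕ) : Set₁ where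
  field
    startOut : ∀ {s u} → start A s → ¬ b s u → nStart s u ≡ 0
    startIn  : ∀ {s u} → start A s → b s u →
               IsLeast (λ k → ∃ λ (σ : Seq (State B) Act) →
                          IsExecution B σ × last σ ≡ u ×
                          CorrespondsVia τ b (oneState s) σ × len σ ≡ k)
                       (nStart s u)
    stepOut  : ∀ {t a s u} → step A t a s → ¬ b s u → nStep t a s u ≡ 0
    stepIn   : ∀ {t a s u} → step A t a s → b s u →
               IsLeast (λ k → ∃ λ (σ : Seq (State B) Act) →
                          IsFragment B σ × last σ ≡ u ×
                          CorrespondsVia τ b (stepSeq t a s) σ × len σ ≡ k)
                       (nStep t a s u)

-- A step of A is matched either by B stuttering inside b (a = τ), or by one a-step of B
-- entering b[s] from b[t], in both cases followed by τ-steps inside b[s].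
-- (1) Starting from u ∈ b[s], repeatedly pick the τ-predecessor of smaller norm that a normed
-- simulation provides; by well-foundedness this ends in a start state (resp. in a state
-- matching t, possibly via one a-step), and the τ-path traversed is the corresponding execution.
-- (2) Conversely, the last step of a shortest corresponding execution ending in u is either
-- the matching a-step from b[t], or a τ-step from some v ∈ b[s] whose removal leaves a
-- strictly shorter corresponding execution ending in v, so the canonical norm drops.

{-# OPTIONS --safe #-}
module Submission where

open import Defs
open import Data.Empty using (⊥-elim)
open import Data.Fin using (Fin; zero; suc; inject₁; fromℕ)
open import Data.Fin.Properties using (≤fromℕ; ≤∧≢⇒<; ≤-antisym; fromℕ≢inject₁; toℕ-inject₁)
open import Data.Fin.Relation.Unary.Top using (view; ‵fromℕ; ‵inject₁)
open import Data.Nat using (ℕ)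
open import Data.Nat as ℕ using (zero; suc; z≤n; s≤s; NonZero)
open import Data.Nat.Properties using (<⇒≱)
open import Data.Product using (_×_; ∃; _,_; proj₂)
open import Data.Sum using (_⊎_; inj₁; inj₂; assocˡ)
open import Data.Unit using (⊤; tt)
open import Data.Vec.Functional as Vector using (_∷_)
open import Function using (_∘_)
open import Induction.WellFounded using (WellFounded; Acc; acc)
open import Relation.Binary.PropositionalEquality using (_≡_; refl; sym; trans; subst; subst₂)
open import Relation.Binary.Structures using (IsStrictPartialOrder)

inject₁<fromℕ : ∀ {n} (i : Fin n) → inject₁ i Data.Fin.< fromℕ n
inject₁<fromℕ i = ≤∧≢⇒< (≤fromℕ (inject₁ i)) (fromℕ≢inject₁ ∘ sym)

inject₁-≤-cancel : ∀ {n} {i j : Fin n} → inject₁ i Data.Fin.≤ inject₁ j → i Data.Fin.≤ j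
inject₁-≤-cancel {i = i} {j} = subst₂ ℕ._≤_ (toℕ-inject₁ i) (toℕ-inject₁ j)

module _ {St Act : Set} where

  prepend : St → Act → Seq St Act → Seq St Act
  prepend v a ρ = mkSeq (suc (len ρ)) (v ∷ st ρ) (a ∷ ac ρ)

  init : (σ : Seq St Act) → .{{NonZero (len σ)}} → Seq St Act
  init (mkSeq (suc m) f g) = mkSeq m (Vector.init f) (Vector.init g)

  record Silent (τ : Act) (P : St → Set) (ρ : Seq St Act) : Set where
    constructor mkSilent
    field
      inside : ∀ j → P (st ρ j)
      silent : ∀ j → ac ρ j ≡ τ

  open Silent public

  module _ {τ : Act} {P : St → Set} where

    Silent-oneState : ∀ {u} → P u → Silent τ P (oneState u)
    Silent-oneState pu = mkSilent (λ _ → pu) (λ ())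

    Silent-prepend : ∀ {v ρ} → P v → Silent τ P ρ → Silent τ P (prepend v τ ρ)
    Silent-prepend pv (mkSilent ins sil) =
      mkSilent (λ { zero → pv ; (suc j) → ins j }) (λ { zero → refl ; (suc j) → sil j })

    Silent-init : ∀ {σ} .{{_ : NonZero (len σ)}} → Silent τ P σ → Silent τ P (init σ)
    Silent-init {mkSeq (suc m) f g} (mkSilent ins sil) = mkSilent (ins ∘ inject₁) (sil ∘ inject₁)

module _ {SA SB Act : Set} {τ : Act} {R : SA → SB → Set} where

  open CorrespondsVia

  oneState-corresponds : ∀ {s σ} → Silent τ (R s) σ → CorrespondsVia τ R (oneState s) σ
  oneState-corresponds (mkSilent ins sil) = record
    { I      = λ _ _ → ⊤
    ; c1     = λ {_} {j} _ → ins j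
    ; c2     = λ { {zero} {_} {zero} _ _ () }
    ; totI   = λ _ → zero , tt
    ; totI⁻¹ = λ _ → zero , tt
    ; c4a    = λ ()
    ; c4b    = λ ()
    ; c4c    = λ _ j _ _ → sil j
    }

  corresponds-oneState-silent : ∀ {s σ} → CorrespondsVia τ R (oneState s) σ → Silent τ (R s) σ
  corresponds-oneState-silent {s} {σ} C =
    mkSilent (λ j → matched (totI⁻¹ C j))
             (λ j → silent-step (totI⁻¹ C (inject₁ j)) (totI⁻¹ C (suc j)))
    where
      matched : ∀ {j} → ∃ (λ i → I C i j) → R s (st σ j)
      matched (zero , Ij) = c1 C Ij
      silent-step : ∀ {j} → ∃ (λ i → I C i (inject₁ j)) → ∃ (λ i → I C i (suc j)) → ac σ j ≡ τ
      silent-step {j} (zero , Ij) (zero , Ij+1) = c4c C zero j Ij Ij+1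

  data StutterMatch {m : ℕ} : Fin 2 → Fin (suc m) → Set where
    t↦first : StutterMatch zero zero
    s↦all   : ∀ {j} → StutterMatch (suc zero) j

  stepSeq-corresponds-stutter : ∀ {t a s ρ} → a ≡ τ → R t (first ρ) → Silent τ (R s) ρ →
                                CorrespondsVia τ R (stepSeq t a s) ρ
  stepSeq-corresponds-stutter a≡τ rt (mkSilent ins sil) = record
    { I      = StutterMatch
    ; c1     = λ { t↦first → rt ; (s↦all {j}) → ins j }
    ; c2     = λ { t↦first s↦all _ → z≤n ; s↦all s↦all (s≤s ()) }
    ; totI   = λ { zero → zero , t↦first ; (suc zero) → zero , s↦all }
    ; totI⁻¹ = λ _ → suc zero , s↦all
    ; c4a    = λ { zero zero t↦first s↦all → trans a≡τ (sym (sil zero)) }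
    ; c4b    = λ { zero _ _ _ → a≡τ }
    ; c4c    = λ _ j _ _ → sil j
    }

  data PrependMatch {m : ℕ} : Fin 2 → Fin (suc (suc m)) → Set where
    t↦head : PrependMatch zero zero
    s↦tail : ∀ {j} → PrependMatch (suc zero) (suc j)

  stepSeq-corresponds-prepend : ∀ {t a s v ρ} → R t v → Silent τ (R s) ρ →
                                CorrespondsVia τ R (stepSeq t a s) (prepend v a ρ)
  stepSeq-corresponds-prepend rt (mkSilent ins sil) = record
    { I      = PrependMatch
    ; c1     = λ { t↦head → rt ; (s↦tail {j}) → ins j }
    ; c2     = λ { t↦head s↦tail _ → z≤n ; s↦tail s↦tail (s≤s ()) }
    ; totI   = λ { zero → zero , t↦head ; (suc zero) → suc zero , s↦tail }
    ; totI⁻¹ = λ { zero → zero , t↦head ; (suc j) → suc zero , s↦tail }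
    ; c4a    = λ { zero zero t↦head s↦tail → refl }
    ; c4b    = λ { zero zero t↦head () }
    ; c4c    = λ { _ (suc j) s↦tail s↦tail → sil j }
    }

  corresponds-last : ∀ {α σ} (C : CorrespondsVia τ R α σ) → I C (fromℕ (len α)) (fromℕ (len σ))
  corresponds-last {α} {σ} C with totI⁻¹ C (fromℕ (len σ)) | totI C (fromℕ (len α))
  ... | i , Ii-last | j , Ilast-j with view i
  ...   | ‵fromℕ      = Ii-last
  ...   | ‵inject₁ i₀ =
    subst (I C (fromℕ (len α)))
          (≤-antisym (≤fromℕ j) (c2 C Ii-last Ilast-j (inject₁<fromℕ i₀)))
          Ilast-j

  corresponds-init : ∀ {α m f g} (C : CorrespondsVia τ R α (mkSeq (suc m) f g)) →
                     I C (fromℕ (len α)) (inject₁ (fromℕ m)) →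
                     CorrespondsVia τ R α (init (mkSeq (suc m) f g))
  corresponds-init {α} {m} C Ilast-penult = record
    { I      = λ i j → I C i (inject₁ j)
    ; c1     = c1 C
    ; c2     = λ Iij Ii′j′ i<i′ → inject₁-≤-cancel (c2 C Iij Ii′j′ i<i′)
    ; totI   = λ i → restrict i (totI C i)
    ; totI⁻¹ = totI⁻¹ C ∘ inject₁
    ; c4a    = λ i j → c4a C i (inject₁ j)
    ; c4b    = λ i j → c4b C i (inject₁ j)
    ; c4c    = λ i j → c4c C i (inject₁ j)
    }
    where
      restrict : ∀ i → ∃ (I C i) → ∃ (I C i ∘ inject₁)
      restrict i (j , Iij) with view j
      ... | ‵inject₁ j₀ = j₀ , Iij
      ... | ‵fromℕ with view i
      ...   | ‵fromℕ      = fromℕ m , Ilast-penult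
      ...   | ‵inject₁ i₀ =
        ⊥-elim (<⇒≱ (inject₁<fromℕ (fromℕ m)) (c2 C Iij Ilast-penult (inject₁<fromℕ i₀)))

  stepSeq-corresponds-state : ∀ {t a s f g} → CorrespondsVia τ R (stepSeq t a s) (mkSeq zero f g) →
                              R t (f zero) × a ≡ τ
  stepSeq-corresponds-state C with totI C zero
  ... | zero , It = c1 C It , c4b C zero zero It (corresponds-last C)

  stepSeq-corresponds-last-step :
    ∀ {t a s m f g} → CorrespondsVia τ R (stepSeq t a s) (mkSeq (suc m) f g) →
    (R t (f (inject₁ (fromℕ m))) × a ≡ g (fromℕ m))
    ⊎ (R s (f (inject₁ (fromℕ m))) × g (fromℕ m) ≡ τ ×
       CorrespondsVia τ R (stepSeq t a s) (init (mkSeq (suc m) f g)))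
  stepSeq-corresponds-last-step {m = m} C with totI⁻¹ C (inject₁ (fromℕ m))
  ... | zero     , It = inj₁ (c1 C It , c4a C zero (fromℕ m) It (corresponds-last C))
  ... | suc zero , Is =
    inj₂ (c1 C Is , c4c C (suc zero) (fromℕ m) Is (corresponds-last C) , corresponds-init C Is)

module _ {Act : Set} {τ : Act} (B : Automaton Act τ) where

  IsFragment-oneState : ∀ u → IsFragment B (oneState u)
  IsFragment-oneState u ()

  IsFragment-prepend : ∀ {v a ρ} → step B v a (first ρ) → IsFragment B ρ → IsFragment B (prepend v a ρ)
  IsFragment-prepend v→ρ fr zero    = v→ρ
  IsFragment-prepend v→ρ fr (suc i) = fr i

  IsFragment-last-step : ∀ {m a} f g → IsFragment B (mkSeq (suc m) f g) → g (fromℕ m) ≡ a →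
                         step B (f (inject₁ (fromℕ m))) a (f (suc (fromℕ m)))
  IsFragment-last-step f g fr refl = fr _

  IsFragment-init : ∀ σ .{{_ : NonZero (len σ)}} → IsFragment B σ → IsFragment B (init σ)
  IsFragment-init (mkSeq (suc m) f g) fr = fr ∘ inject₁

  module _ {S : Set} {_<_ : S → S → Set} (P Base : State B → Set) (n : State B → S)
           (descend : ∀ {u} → P u → Base u ⊎ ∃ λ v → P v × step B v τ u × n v < n u) where

    SilentPathFromBase : State B → Set
    SilentPathFromBase u =
      ∃ λ σ → IsFragment B σ × Silent τ P σ × Base (first σ) × last σ ≡ u

    extend-to-base : ∀ ρ → Acc _<_ (n (first ρ)) → IsFragment B ρ → Silent τ P ρ →
                     SilentPathFromBase (last ρ)
    extend-to-base ρ (acc smaller) fr sil with descend (inside sil zero)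
    ... | inj₁ base                = ρ , fr , sil , base , refl
    ... | inj₂ (v , pv , v→ρ , n<) =
      extend-to-base (prepend v τ ρ) (smaller n<) (IsFragment-prepend v→ρ fr) (Silent-prepend pv sil)

    silent-path-from-base : WellFounded _<_ → ∀ {u} → P u → SilentPathFromBase u
    silent-path-from-base wf {u} pu =
      extend-to-base (oneState u) (wf (n u)) (IsFragment-oneState u) (Silent-oneState pu)

module _ {Act : Set} {τ : Act} {A B : Automaton Act τ} {b : State A → State B → Set} where

  normed⇒branching : ∀ {S} {_<ₛ_ : S → S → Set} {nStart nStep} → WellFounded _<ₛ_ →
                     NormedBackSim A B b _<ₛ_ nStart nStep → BranchingBackSim A B b
  normed⇒branching {nStart = nStart} {nStep} wf N =
    record { total = total ; cond1 = from-start ; cond2 = from-step }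
    where
      open NormedBackSim N

      from-start : ∀ {s u} → start A s → b s u →
                   ∃ λ σ → IsExecution B σ × last σ ≡ u × CorrespondsVia τ b (oneState s) σ
      from-start {s} s₀ bsu with silent-path-from-base B (b s) (start B) (nStart s) (cond1 s₀) wf bsu
      ... | σ , fr , sil , σ₀ , ends = σ , (fr , σ₀) , ends , oneState-corresponds sil

      from-step : ∀ {t a s u} → step A t a s → b s u →
                  ∃ λ σ → IsFragment B σ × last σ ≡ u × CorrespondsVia τ b (stepSeq t a s) σ
      from-step {t} {a} {s} t→s bsu
        with silent-path-from-base B (b s) (λ w → (b t w × a ≡ τ) ⊎ ∃ λ v → b t v × step B v a w)
                                   (nStep t a s) (assocˡ ∘ cond2 t→s) wf bsu
      ... | σ , fr , sil , inj₁ (bt , a≡τ) , ends =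
        σ , fr , ends , stepSeq-corresponds-stutter a≡τ bt sil
      ... | σ , fr , sil , inj₂ (v , bt , v→σ) , ends =
        prepend v a σ , IsFragment-prepend B v→σ fr , ends , stepSeq-corresponds-prepend bt sil

  canonical⇒normed : ∀ {nStart nStep} → BranchingBackSim A B b → CanonicalNorm A B b nStart nStep →
                     NormedBackSim A B b ℕ._<_ nStart nStep
  canonical⇒normed {nStart} {nStep} br cn =
    record { total = BranchingBackSim.total br ; cond1 = from-start ; cond2 = from-step }
    where
      open CanonicalNorm cn

      from-start : ∀ {s u} → start A s → b s u →
                   start B u ⊎ ∃ λ v → b s v × step B v τ u × nStart s v ℕ.< nStart s u
      from-start {s} s₀ bsu with startIn s₀ bsu
      ... | (mkSeq zero f g , (_ , σ₀) , refl , _ , _) , _ = inj₁ σ₀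
      ... | (σ@(mkSeq (suc m) f g) , (fr , σ₀) , refl , C , len≡) , _ =
        inj₂ (v , bsv , IsFragment-last-step B f g fr (silent sil (fromℕ m)) ,
              subst (nStart s v ℕ.<_) len≡ (s≤s shorter))
        where
          sil : Silent τ (b s) σ
          sil = corresponds-oneState-silent C
          v : State B
          v = f (inject₁ (fromℕ m))
          bsv : b s v
          bsv = inside sil (inject₁ (fromℕ m))
          shorter : nStart s v ℕ.≤ m
          shorter = proj₂ (startIn s₀ bsv) m
            (init σ , (IsFragment-init B σ fr , σ₀) , refl , oneState-corresponds (Silent-init sil) , refl)

      from-step : ∀ {t a s u} → step A t a s → b s u →
                  (b t u × a ≡ τ) ⊎ (∃ λ v → b t v × step B v a u)
                  ⊎ (∃ λ v → b s v × step B v τ u × nStep t a s v ℕ.< nStep t a s u)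
      from-step {t} {a} {s} t→s bsu with stepIn t→s bsu
      ... | (mkSeq zero f g , _ , refl , C , _) , _ = inj₁ (stepSeq-corresponds-state C)
      ... | (σ@(mkSeq (suc m) f g) , fr , refl , C , len≡) , _ with stepSeq-corresponds-last-step C
      ...   | inj₁ (btv , a≡g) = inj₂ (inj₁ (_ , btv , IsFragment-last-step B f g fr (sym a≡g)))
      ...   | inj₂ (bsv , g≡τ , C′) =
        inj₂ (inj₂ (v , bsv , IsFragment-last-step B f g fr g≡τ ,
                    subst (nStep t a s v ℕ.<_) len≡ (s≤s shorter)))
        where
          v : State B
          v = f (inject₁ (fromℕ m))
          shorter : nStep t a s v ℕ.≤ m
          shorter = proj₂ (stepIn t→s bsv) m (init σ , IsFragment-init B σ fr , refl , C′ , refl)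

theorem5p5 : {Act : Set} {τ : Act} (A B : Automaton Act τ) →
    ((b : State A → State B → Set) (S : Set) (_<ₛ_ : S → S → Set) →
      IsStrictPartialOrder _≡_ _<ₛ_ → WellFounded _<ₛ_ →
      (nStart : State A → State B → S) →
      (nStep : State A → Act → State A → State B → S) →
      NormedBackSim A B b _<ₛ_ nStart nStep → BranchingBackSim A B b)
    × ((b : State A → State B → Set) → BranchingBackSim A B b →
      (nStart : State A → State B → ℕ) →
      (nStep : State A → Act → State A → State B → ℕ) →
      CanonicalNorm A B b nStart nStep →
      NormedBackSim A B b Data.Nat._<_ nStart nStep)
theorem5p5 A B =
  (λ _ _ _ _ wf _ _ → normed⇒branching wf) ,
  (λ _ br _ _ → canonical⇒normed br)
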